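{- Let $t$ be a positive integer and let $\mathcal T:\Sigma(R,C)\to\Sigma(R',C')$ be the $t$-scaling map (constructed from some $D_0\in\Sigma(R,C)$). Then: (1) for every $Y\in\Sigma(R',C')$, $|\mathcal T^{ -1}(Y)|\le t^{(m-1)(n-1)}$; (2) for every set $S\subset\{(i,j):1\le i\le m,1\le j\le n\}$ and every $D\in\Sigma(R,C)$, $$t^{ -1}\sigma_S(D)\le\sigma_S(\mathcal T(D))\le t^{ -1}\sigma_S(D)+5|S|.$$
   Context: Let $R=(r_1,\ldots,r_m)$, $C=(c_1,\ldots,c_n)$ be positive integer vectors with equal sums; $\Sigma(R,C)$ is the set of $m\times n$ non-negative integer matrices with row sums $R$ and column sums $C$. For a matrix $A=(a_{ij})$, $\sigma_S(A)=\sum_{(i,j)\in S}a_{ij}$. Let $\Lambda$ be the lattice of $m\times n$ integer matrices with all row and column sums $0$. For $1\le i\le m-1$, $1\le j\le n-1$ let $U_{ij}$ be the matrix with $1$ in positions $(i,j)$ and $(i+1,j+1)$, $-1$ in positions $(i+1,j)$ and $(i,j+1)$, and $0$ elsewhere; these form a basis of $\Lambda$. The standard parallelepiped is $\Pi=\{\sum_{i,j}\lambda_{ij}U_{ij}:0\le\lambda_{ij}<1\}$. The $t$-scaling map: fix $t\in\mathbb Z_{>0}$ and any $D_0\in\Sigma(R,C)$. Let $D_1$ be obtained by rounding each entry of $t^{ -1}D_0$ up to the nearest integer and adding $2$; let $B=D_1-t^{ -1}D_0$ (so $2\le b_{ij}<3$), and let $R',C'$ be the row and column sums of $D_1$. For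 a real matrix $X$ with row sums $R'$ and column sums $C'$, let $\lfloor X\rfloor$ be the unique integer matrix $Y$ (necessarily with row sums $R'$, column sums $C'$) such that $X\in Y+\Pi$. Define $\mathcal T(D)=\lfloor t^{ -1}D+B\rfloor$ for $D\in\Sigma(R,C)$; this is a non-negative integer matrix, so $\mathcal T:\Sigma(R,C)\to\Sigma(R',C')$. -}

module Defs where

open import Data.Nat as ℕ using (ℕ; zero; suc; NonZero)
open import Data.Integer as ℤ using (ℤ; +_)
open import Data.Rational as ℚ using (ℚ; 0ℚ; 1ℚ; _≤_; _<_; ceiling)
open import Data.Fin using (Fin; zero; suc; inject₁)
import Data.Fin as Fin
open import Data.Bool using (Bool; true; false; if_then_else_)
open import Data.Product using (Σ; _×_; ∃)
open import Data.List using (List; length)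
open import Data.List.Relation.Unary.All using (All)
open import Data.List.Relation.Unary.AllPairs using (AllPairs)
open import Relation.Nullary using (¬_; yes; no)
open import Relation.Binary.PropositionalEquality using (_≡_)

Mat : Set → ℕ → ℕ → Set
Mat A m n = Fin m → Fin n → A

sumℕ : {k : ℕ} → (Fin k → ℕ) → ℕ
sumℕ {zero}  f = 0
sumℕ {suc k} f = f zero ℕ.+ sumℕ (λ i → f (suc i))

sumℚ : {k : ℕ} → (Fin k → ℚ) → ℚ
sumℚ {zero}  f = 0ℚ
sumℚ {suc k} f = f zero ℚ.+ sumℚ (λ i → f (suc i))

ℤ→ℚ : ℤ → ℚ
ℤ→ℚ z = z ℚ./ 1

ℕ→ℚ : ℕ → ℚ
ℕ→ℚ k = ℤ→ℚ (+ k)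

rowSums : {m n : ℕ} → Mat ℕ m n → Fin m → ℕ
rowSums A i = sumℕ (λ j → A i j)

colSums : {m n : ℕ} → Mat ℕ m n → Fin n → ℕ
colSums A j = sumℕ (λ i → A i j)

InΣ : {m n : ℕ} → (Fin m → ℕ) → (Fin n → ℕ) → Mat ℕ m n → Set
InΣ R C D = (∀ i → rowSums D i ≡ R i) × (∀ j → colSums D j ≡ C j)

_≈M_ : {A : Set} {m n : ℕ} → Mat A m n → Mat A m n → Set
A ≈M B = ∀ i j → A i j ≡ B i j

δ : {k : ℕ} → Fin k → Fin k → ℚ
δ p q with p Fin.≟ q
... | yes _ = 1ℚ
... | no  _ = 0ℚ

-- basis matrix U_{ij} of the lattice Λ, for an (a+1) × (b+1) matrix, i : Fin a, j : Fin b;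
-- rows i, i+1 are  inject₁ i, suc i  (similarly for columns)
U : {a b : ℕ} → Fin a → Fin b → Mat ℚ (suc a) (suc b)
U i j p q =
  ((δ p (inject₁ i) ℚ.* δ q (inject₁ j)) ℚ.+ (δ p (suc i) ℚ.* δ q (suc j)))
  ℚ.- ((δ p (suc i) ℚ.* δ q (inject₁ j)) ℚ.+ (δ p (inject₁ i) ℚ.* δ q (suc j)))

InΠ : {a b : ℕ} → Mat ℚ (suc a) (suc b) → Set
InΠ {a} {b} Z =
  Σ (Fin a → Fin b → ℚ) λ lam →
    (∀ i j → (0ℚ ≤ lam i j) × (lam i j < 1ℚ)) ×
    (∀ p q → Z p q ≡ sumℚ (λ i → sumℚ (λ j → lam i j ℚ.* U i j p q)))

scaleInv : {m n : ℕ} (t : ℕ) .{{_ : NonZero t}} → Mat ℕ m n → Mat ℚ m n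
scaleInv t D i j = (+ D i j) ℚ./ t

D₁ : {m n : ℕ} (t : ℕ) .{{_ : NonZero t}} → Mat ℕ m n → Mat ℤ m n
D₁ t D₀ i j = ceiling (scaleInv t D₀ i j) ℤ.+ + 2

Bmat : {m n : ℕ} (t : ℕ) .{{_ : NonZero t}} → Mat ℕ m n → Mat ℚ m n
Bmat t D₀ i j = ℤ→ℚ (D₁ t D₀ i j) ℚ.- scaleInv t D₀ i j

rowSumsℤ : {m n : ℕ} → Mat ℤ m n → Fin m → ℤ
rowSumsℤ {m} {n} A i = sumℤ (λ j → A i j)
  where
  sumℤ : {k : ℕ} → (Fin k → ℤ) → ℤ
  sumℤ {zero} f = + 0
  sumℤ {suc k} f = f zero ℤ.+ sumℤ (λ i → f (suc i))

colSumsℤ : {m n : ℕ} → Mat ℤ m n → Fin n → ℤ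
colSumsℤ {m} {n} A j = sumℤ (λ i → A i j)
  where
  sumℤ : {k : ℕ} → (Fin k → ℤ) → ℤ
  sumℤ {zero} f = + 0
  sumℤ {suc k} f = f zero ℤ.+ sumℤ (λ i → f (suc i))

-- Y ∈ Σ(R',C') where R', C' are the row/column sums of D₁
InΣ' : {m n : ℕ} → Mat ℤ m n → Mat ℕ m n → Set
InΣ' D Y = (∀ i → + rowSums Y i ≡ rowSumsℤ D i) × (∀ j → + colSums Y j ≡ colSumsℤ D j)

-- T is the t-scaling map on Σ(R,C) (built from D₀):
-- for every D ∈ Σ(R,C), T D is an integer matrix with  t^{-1} D + B ∈ T D + Π,
-- i.e. T D = ⌊ t^{-1} D + B ⌋ (such a matrix is unique).
IsTScaling : {a b : ℕ} (t : ℕ) .{{_ : NonZero t}} →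
             (Fin (suc a) → ℕ) → (Fin (suc b) → ℕ) → Mat ℕ (suc a) (suc b) →
             (Mat ℕ (suc a) (suc b) → Mat ℤ (suc a) (suc b)) → Set
IsTScaling t R C D₀ T =
  ∀ D → InΣ R C D →
    InΠ (λ p q → (scaleInv t D p q ℚ.+ Bmat t D₀ p q) ℚ.- ℤ→ℚ (T D p q))

σℚ : {m n : ℕ} → (Fin m → Fin n → Bool) → Mat ℚ m n → ℚ
σℚ S A = sumℚ (λ i → sumℚ (λ j → if S i j then A i j else 0ℚ))

card : {m n : ℕ} → (Fin m → Fin n → Bool) → ℕ
card S = sumℕ (λ i → sumℕ (λ j → if S i j then 1 else 0))

module Submission where

-- For D ∈ Σ(R,C) put s = t⁻¹D.
-- By definition s + B - T(D) = Σ λ_ij U_ij for some λ ∈ [0,1)^{a×b}.  Since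
-- U_ij = (e_i - e_{i+1}) ⊗ (e_j - e_{j+1}), this point is the double backward difference ΔΔλ
-- of λ padded by zeros.  Hence:
--  * its entries lie in (-2,2); with B ∈ [2,3) each entry of T(D) lies in [s, s + 5], and
--    summing over S gives part (2);
--  * its block sums Σ_{p≤i, q≤j} recover λ_ij.  For D, D′ in one fibre this gives
--    t(λ - λ′) = N - N′, where N, N′ are the integer block sums of D, D′.  As |λ - λ′| < 1,
--    the residues of N modulo t determine N, hence λ, hence D; so a fibre injects into
--    (ℤ/t)^{ab}, which is part (1).
-- The file develops, in order: the embedding ℤ → ℚ and ceilings; finite sums, the difference
-- operator Δ and the factorisation of U; bounds on Σ λ_ij U_ij and part (2); prefix and block
-- sums inverting Δ; the fibre argument and a pigeonhole count; finally lemma4p3.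

open import Defs
open import Data.Nat as ℕ using (ℕ; zero; suc; NonZero; _^_; _*_)
import Data.Nat.Properties as ℕP
open import Data.Nat.DivMod using (m≡m%n+[m/n]*n; m%n<n)
open import Data.Integer as ℤ using (ℤ; +_)
import Data.Integer.Properties as ℤP
import Data.Integer.DivMod as ℤD
open import Data.Rational as ℚ using (ℚ; mkℚ; 0ℚ; 1ℚ; _≤_; _<_; toℚᵘ; floor; ceiling)
import Data.Rational.Properties as ℚP
open import Data.Rational.Unnormalised as ℚᵘ using (mkℚᵘ; *≡*; *≤*; *<*)
import Data.Rational.Unnormalised.Properties as ℚᵘP
open import Data.Rational.Solver using (module +-*-Solver)
open import Data.Fin as Fin using (Fin; zero; suc; inject₁)
import Data.Fin.Properties as FinP
open import Data.Bool using (Bool; true; false; if_then_else_)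
open import Data.Product using (_×_; _,_; proj₁; proj₂)
open import Data.Sum using (_⊎_; inj₁; inj₂)
open import Data.Empty using (⊥-elim)
open import Data.List using (List; length; lookup)
import Data.List.Relation.Unary.All as All
open All using (All)
open import Data.List.Membership.Propositional.Properties using (∈-lookup)
open import Data.List.Relation.Unary.AllPairs using (AllPairs; _∷_)
open import Relation.Nullary using (¬_; Dec; yes; no)
open import Relation.Binary.Definitions using (tri<; tri≈; tri>)
open import Relation.Binary.PropositionalEquality
open +-*-Solver
open import Algebra.Properties.Group ℚP.+-0-group using ()
  renaming ( ⁻¹-involutive to neg-involutive
           ; x∙y⁻¹≈ε⇒x≈y to x-y≡0⇒x≡y
           ; x≈y⇒x∙y⁻¹≈ε to x≡y⇒x-y≡0 )

ι : ℤ → ℚ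
ι = ℤ→ℚ

toℚᵘ-ι : ∀ z → toℚᵘ (ι z) ℚᵘ.≃ mkℚᵘ z 0
toℚᵘ-ι z = ℚP.toℚᵘ-fromℚᵘ (mkℚᵘ z 0)

ι-+ : ∀ x y → ι (x ℤ.+ y) ≡ ι x ℚ.+ ι y
ι-+ x y = ℚP.toℚᵘ-injective (begin
    toℚᵘ (ι (x ℤ.+ y))              ≈⟨ toℚᵘ-ι (x ℤ.+ y) ⟩
    mkℚᵘ (x ℤ.+ y) 0                ≈⟨ *≡* (cong₂ (λ u v → (u ℤ.+ v) ℤ.* + 1)
                                              (sym (ℤP.*-identityʳ x)) (sym (ℤP.*-identityʳ y))) ⟩
    mkℚᵘ x 0 ℚᵘ.+ mkℚᵘ y 0          ≈⟨ ℚᵘP.≃-sym (ℚᵘP.+-cong (toℚᵘ-ι x) (toℚᵘ-ι y)) ⟩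
    toℚᵘ (ι x) ℚᵘ.+ toℚᵘ (ι y)      ≈⟨ ℚᵘP.≃-sym (ℚP.toℚᵘ-homo-+ (ι x) (ι y)) ⟩
    toℚᵘ (ι x ℚ.+ ι y)              ∎)
  where open ℚᵘP.≃-Reasoning

ι-* : ∀ x y → ι (x ℤ.* y) ≡ ι x ℚ.* ι y
ι-* x y = ℚP.toℚᵘ-injective (begin
    toℚᵘ (ι (x ℤ.* y))              ≈⟨ toℚᵘ-ι (x ℤ.* y) ⟩
    mkℚᵘ x 0 ℚᵘ.* mkℚᵘ y 0          ≈⟨ ℚᵘP.≃-sym (ℚᵘP.*-cong (toℚᵘ-ι x) (toℚᵘ-ι y)) ⟩
    toℚᵘ (ι x) ℚᵘ.* toℚᵘ (ι y)      ≈⟨ ℚᵘP.≃-sym (ℚP.toℚᵘ-homo-* (ι x) (ι y)) ⟩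
    toℚᵘ (ι x ℚ.* ι y)              ∎)
  where open ℚᵘP.≃-Reasoning

ι-neg : ∀ x → ι (ℤ.- x) ≡ ℚ.- ι x
ι-neg x = ℚP.toℚᵘ-injective (begin
    toℚᵘ (ι (ℤ.- x))                ≈⟨ toℚᵘ-ι (ℤ.- x) ⟩
    ℚᵘ.- mkℚᵘ x 0                   ≈⟨ ℚᵘP.-‿cong (ℚᵘP.≃-sym (toℚᵘ-ι x)) ⟩
    ℚᵘ.- toℚᵘ (ι x)                 ≈⟨ ℚᵘP.≃-sym (ℚP.toℚᵘ-homo‿- (ι x)) ⟩
    toℚᵘ (ℚ.- ι x)                  ∎)
  where open ℚᵘP.≃-Reasoning

ι-mono-< : ∀ {x y} → x ℤ.< y → ι x < ι y
ι-mono-< {x} {y} x<y = ℚP.toℚᵘ-cancel-<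
  (ℚᵘP.<-respˡ-≃ (ℚᵘP.≃-sym (toℚᵘ-ι x)) (ℚᵘP.<-respʳ-≃ (ℚᵘP.≃-sym (toℚᵘ-ι y))
    (*<* (subst₂ ℤ._<_ (sym (ℤP.*-identityʳ x)) (sym (ℤP.*-identityʳ y)) x<y))))

ι-cancel-≤ : ∀ {x y} → ι x ≤ ι y → x ℤ.≤ y
ι-cancel-≤ {x} {y} le
  with ℚᵘP.≤-respˡ-≃ (toℚᵘ-ι x) (ℚᵘP.≤-respʳ-≃ (toℚᵘ-ι y) (ℚP.toℚᵘ-mono-≤ le))
... | *≤* x*1≤y*1 = subst₂ ℤ._≤_ (ℤP.*-identityʳ x) (ℤP.*-identityʳ y) x*1≤y*1

ι-cancel-< : ∀ {x y} → ι x < ι y → x ℤ.< y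
ι-cancel-< {x} {y} lt
  with ℚᵘP.<-respˡ-≃ (toℚᵘ-ι x) (ℚᵘP.<-respʳ-≃ (toℚᵘ-ι y) (ℚP.toℚᵘ-mono-< lt))
... | *<* x*1<y*1 = subst₂ ℤ._<_ (ℤP.*-identityʳ x) (ℤP.*-identityʳ y) x*1<y*1

ℕ→ℚ-+ : ∀ m n → ℕ→ℚ (m ℕ.+ n) ≡ ℕ→ℚ m ℚ.+ ℕ→ℚ n
ℕ→ℚ-+ m n = ι-+ (+ m) (+ n)

ℕ→ℚ-* : ∀ m n → ℕ→ℚ (m * n) ≡ ℕ→ℚ m ℚ.* ℕ→ℚ n
ℕ→ℚ-* m n = trans (cong ι (ℤP.pos-* m n)) (ι-* (+ m) (+ n))

ℕ→ℚ-cancel-< : ∀ {m n} → ℕ→ℚ m < ℕ→ℚ n → m ℕ.< n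
ℕ→ℚ-cancel-< {m} {n} lt with ι-cancel-< {+ m} {+ n} lt
... | ℤ.+<+ m<n = m<n

ℕ→ℚ-injective : ∀ {m n} → ℕ→ℚ m ≡ ℕ→ℚ n → m ≡ n
ℕ→ℚ-injective {m} {n} e = ℤP.+-injective (ℤP.≤-antisym
  (ι-cancel-≤ {+ m} {+ n} (ℚP.≤-reflexive e)) (ι-cancel-≤ {+ n} {+ m} (ℚP.≤-reflexive (sym e))))

ℕ→ℚ-suc-positive : ∀ t′ → ℚ.Positive (ℕ→ℚ (suc t′))
ℕ→ℚ-suc-positive t′ = ℚ.positive {ℕ→ℚ (suc t′)} (ι-mono-< {+ 0} {+ suc t′} (ℤ.+<+ (ℕ.s≤s ℕ.z≤n)))

ℕ→ℚ-*-/ : ∀ t′ n → ℕ→ℚ (suc t′) ℚ.* ((+ n) ℚ./ suc t′) ≡ ℕ→ℚ n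
ℕ→ℚ-*-/ t′ n = ℚP.toℚᵘ-injective (begin
    toℚᵘ (ℕ→ℚ (suc t′) ℚ.* ((+ n) ℚ./ suc t′))
      ≈⟨ ℚP.toℚᵘ-homo-* (ℕ→ℚ (suc t′)) ((+ n) ℚ./ suc t′) ⟩
    toℚᵘ (ℕ→ℚ (suc t′)) ℚᵘ.* toℚᵘ ((+ n) ℚ./ suc t′)
      ≈⟨ ℚᵘP.*-cong (toℚᵘ-ι (+ suc t′)) (ℚP.toℚᵘ-fromℚᵘ (mkℚᵘ (+ n) t′)) ⟩
    mkℚᵘ (+ suc t′) 0 ℚᵘ.* mkℚᵘ (+ n) t′
      ≈⟨ *≡* (trans (ℤP.*-identityʳ (+ suc t′ ℤ.* + n))
               (trans (ℤP.*-comm (+ suc t′) (+ n)) (cong (λ d → + n ℤ.* + d) (sym (ℕP.*-identityˡ (suc t′)))))) ⟩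
    mkℚᵘ (+ n) 0
      ≈⟨ ℚᵘP.≃-sym (toℚᵘ-ι (+ n)) ⟩
    toℚᵘ (ℕ→ℚ n) ∎)
  where open ℚᵘP.≃-Reasoning

-- ⌊ p ⌋ ≤ p < ⌊ p ⌋ + 1, from the division algorithm on the numerator.
floor-≤ : ∀ p → ι (floor p) ≤ p
floor-≤ p@(mkℚ n d _) = ℚP.toℚᵘ-cancel-≤ (ℚᵘP.≤-respˡ-≃ (ℚᵘP.≃-sym (toℚᵘ-ι (floor p)))
  (*≤* (subst (ℤ._≤_ _) (sym (ℤP.*-identityʳ n)) (ℤD.[n/d]*d≤n n (+ suc d)))))

floor-< : ∀ p → p < ι (floor p ℤ.+ + 1)
floor-< p@(mkℚ n d _) = ℚP.toℚᵘ-cancel-< (ℚᵘP.<-respʳ-≃ (ℚᵘP.≃-sym (toℚᵘ-ι (f ℤ.+ + 1)))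
    (*<* (subst₂ ℤ._<_ (sym (ℤP.*-identityʳ n)) quot+1 n<d+f*d)))
  where
  f : ℤ
  f = floor p
  n<d+f*d : n ℤ.< + suc d ℤ.+ f ℤ.* + suc d
  n<d+f*d = subst (ℤ._< + suc d ℤ.+ f ℤ.* + suc d) (sym (ℤD.a≡a%n+[a/n]*n n (+ suc d)))
    (ℤP.+-monoˡ-< (f ℤ.* + suc d) (ℤ.+<+ (ℤD.n%d<d n (+ suc d))))
  quot+1 : + suc d ℤ.+ f ℤ.* + suc d ≡ (f ℤ.+ + 1) ℤ.* + suc d
  quot+1 = trans (ℤP.+-comm (+ suc d) (f ℤ.* + suc d))
    (sym (trans (ℤP.*-distribʳ-+ (+ suc d) f (+ 1)) (cong (λ z → f ℤ.* + suc d ℤ.+ z) (ℤP.*-identityˡ (+ suc d)))))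

-- ⌈ p ⌉ = - ⌊ - p ⌋, hence p ≤ ⌈ p ⌉ < p + 1.
ceiling≡-floor- : ∀ p → ι (ceiling p) ≡ ℚ.- ι (floor (ℚ.- p))
ceiling≡-floor- p@(mkℚ _ _ _) = ι-neg (floor (ℚ.- p))

ceiling-≥ : ∀ p → p ≤ ι (ceiling p)
ceiling-≥ p = subst₂ _≤_ (neg-involutive p) (sym (ceiling≡-floor- p))
  (ℚP.neg-antimono-≤ (floor-≤ (ℚ.- p)))

ceiling-< : ∀ p → ι (ceiling p) < p ℚ.+ 1ℚ
ceiling-< p = subst₂ _<_ eq refl (ℚP.+-monoˡ-< 1ℚ below)
  where
  f : ℤ
  f = floor (ℚ.- p)
  below : ℚ.- ι (f ℤ.+ + 1) < p
  below = subst (ℚ.- ι (f ℤ.+ + 1) <_) (neg-involutive p) (ℚP.neg-antimono-< (floor-< (ℚ.- p)))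
  eq : ℚ.- ι (f ℤ.+ + 1) ℚ.+ 1ℚ ≡ ι (ceiling p)
  eq = begin
    ℚ.- ι (f ℤ.+ + 1) ℚ.+ 1ℚ   ≡⟨ cong (λ z → ℚ.- z ℚ.+ 1ℚ) (ι-+ f (+ 1)) ⟩
    ℚ.- (ι f ℚ.+ 1ℚ) ℚ.+ 1ℚ     ≡⟨ solve 1 (λ y → :- (y :+ con 1ℚ) :+ con 1ℚ := :- y) refl (ι f) ⟩
    ℚ.- ι f                     ≡⟨ sym (ceiling≡-floor- p) ⟩
    ι (ceiling p)               ∎
    where open ≡-Reasoning

sum-cong : ∀ {k} {f g : Fin k → ℚ} → (∀ i → f i ≡ g i) → sumℚ f ≡ sumℚ g
sum-cong {zero}  f≗g = refl
sum-cong {suc k} f≗g = cong₂ ℚ._+_ (f≗g zero) (sum-cong (λ i → f≗g (suc i)))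

sum-+ : ∀ {k} (f g : Fin k → ℚ) → sumℚ (λ i → f i ℚ.+ g i) ≡ sumℚ f ℚ.+ sumℚ g
sum-+ {zero}  f g = refl
sum-+ {suc k} f g = trans (cong (f zero ℚ.+ g zero ℚ.+_) (sum-+ (λ i → f (suc i)) (λ i → g (suc i))))
  (solve 4 (λ a b c d → (a :+ b) :+ (c :+ d) := (a :+ c) :+ (b :+ d)) refl (f zero) (g zero) _ _)

sum-scale : ∀ {k} (c : ℚ) (f : Fin k → ℚ) → sumℚ (λ i → c ℚ.* f i) ≡ c ℚ.* sumℚ f
sum-scale {zero}  c f = sym (ℚP.*-zeroʳ c)
sum-scale {suc k} c f = trans (cong (c ℚ.* f zero ℚ.+_) (sum-scale c (λ i → f (suc i))))
  (sym (ℚP.*-distribˡ-+ c (f zero) _))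

sum-- : ∀ {k} (f g : Fin k → ℚ) → sumℚ (λ i → f i ℚ.- g i) ≡ sumℚ f ℚ.- sumℚ g
sum-- {zero}  f g = refl
sum-- {suc k} f g = trans (cong (f zero ℚ.- g zero ℚ.+_) (sum-- (λ i → f (suc i)) (λ i → g (suc i))))
  (solve 4 (λ a b c d → (a :- b) :+ (c :- d) := (a :+ c) :- (b :+ d)) refl (f zero) (g zero) _ _)

sum-zero : ∀ {k} (f : Fin k → ℚ) → (∀ i → f i ≡ 0ℚ) → sumℚ f ≡ 0ℚ
sum-zero {zero}  f f≗0 = refl
sum-zero {suc k} f f≗0 = cong₂ ℚ._+_ (f≗0 zero) (sum-zero (λ i → f (suc i)) (λ i → f≗0 (suc i)))

sum-mono : ∀ {k} {f g : Fin k → ℚ} → (∀ i → f i ≤ g i) → sumℚ f ≤ sumℚ g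
sum-mono {zero}  f≤g = ℚP.≤-refl
sum-mono {suc k} f≤g = ℚP.+-mono-≤ (f≤g zero) (sum-mono (λ i → f≤g (suc i)))

ℕ→ℚ-sum : ∀ {k} (f : Fin k → ℕ) → ℕ→ℚ (sumℕ f) ≡ sumℚ (λ i → ℕ→ℚ (f i))
ℕ→ℚ-sum {zero}  f = refl
ℕ→ℚ-sum {suc k} f = trans (ℕ→ℚ-+ (f zero) _) (cong (ℕ→ℚ (f zero) ℚ.+_) (ℕ→ℚ-sum (λ i → f (suc i))))

δ-diag : ∀ {k} (p : Fin k) → δ p p ≡ 1ℚ
δ-diag p with p Fin.≟ p
... | yes _  = refl
... | no p≢p = ⊥-elim (p≢p refl)

δ-off : ∀ {k} {p q : Fin k} → p ≢ q → δ p q ≡ 0ℚ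
δ-off {p = p} {q} p≢q with p Fin.≟ q
... | yes p≡q = ⊥-elim (p≢q p≡q)
... | no _    = refl

δ-suc : ∀ {k} (p q : Fin k) → δ (suc p) (suc q) ≡ δ p q
δ-suc p q = by-cases (p Fin.≟ q)
  where
  by-cases : Dec (p ≡ q) → δ (suc p) (suc q) ≡ δ p q
  by-cases (yes refl) = trans (δ-diag (suc p)) (sym (δ-diag p))
  by-cases (no p≢q)   = trans (δ-off (λ e → p≢q (FinP.suc-injective e))) (sym (δ-off p≢q))

*-δ-off : ∀ {k} x {p q : Fin k} → p ≢ q → x ℚ.* δ p q ≡ 0ℚ
*-δ-off x p≢q = trans (cong (x ℚ.*_) (δ-off p≢q)) (ℚP.*-zeroʳ x)

sift : ∀ {k} (g : Fin k → ℚ) (q : Fin k) → sumℚ (λ j → g j ℚ.* δ q j) ≡ g q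
sift {suc k} g zero = trans
  (cong₂ ℚ._+_ (ℚP.*-identityʳ (g zero)) (sum-zero _ (λ j → *-δ-off (g (suc j)) {zero} {suc j} (λ ()))))
  (ℚP.+-identityʳ (g zero))
sift {suc k} g (suc q) = trans
  (cong₂ ℚ._+_ (*-δ-off (g zero) {suc q} {zero} (λ ()))
    (trans (sum-cong (λ j → cong (g (suc j) ℚ.*_) (δ-suc q j))) (sift (λ j → g (suc j)) q)))
  (ℚP.+-identityˡ (g (suc q)))

-- Padding g : Fin a → ℚ by a zero at the end (padʳ) or at the front (padˡ); their
-- difference Δ g is the backward difference of the sequence 0, g₀, …, g_{a-1}, 0.
padʳ : ∀ {a} → (Fin a → ℚ) → Fin (suc a) → ℚ
padʳ {zero}  g zero    = 0ℚ
padʳ {suc a} g zero    = g zero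
padʳ {suc a} g (suc q) = padʳ (λ j → g (suc j)) q

padˡ : ∀ {a} → (Fin a → ℚ) → Fin (suc a) → ℚ
padˡ g zero    = 0ℚ
padˡ g (suc q) = g q

Δ : ∀ {a} → (Fin a → ℚ) → Fin (suc a) → ℚ
Δ g q = padʳ g q ℚ.- padˡ g q

step : ∀ {a} → Fin a → Fin (suc a) → ℚ
step j q = δ q (inject₁ j) ℚ.- δ q (suc j)

U≡step⊗step : ∀ {a b} (i : Fin a) (j : Fin b) p q → U i j p q ≡ step i p ℚ.* step j q
U≡step⊗step i j p q =
  solve 4 (λ a b c d → ((a :* c) :+ (b :* d)) :- ((b :* c) :+ (a :* d)) := (a :- b) :* (c :- d)) refl
    (δ p (inject₁ i)) (δ p (suc i)) (δ q (inject₁ j)) (δ q (suc j))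

sift-padʳ : ∀ {a} (g : Fin a → ℚ) q → sumℚ (λ j → g j ℚ.* δ q (inject₁ j)) ≡ padʳ g q
sift-padʳ {zero}  g zero    = refl
sift-padʳ {suc a} g zero    = trans
  (cong₂ ℚ._+_ (ℚP.*-identityʳ (g zero)) (sum-zero _ (λ j → *-δ-off (g (suc j)) {zero} {suc (inject₁ j)} (λ ()))))
  (ℚP.+-identityʳ (g zero))
sift-padʳ {suc a} g (suc q) = trans
  (cong₂ ℚ._+_ (*-δ-off (g zero) {suc q} {zero} (λ ()))
    (trans (sum-cong (λ j → cong (g (suc j) ℚ.*_) (δ-suc q (inject₁ j)))) (sift-padʳ (λ j → g (suc j)) q)))
  (ℚP.+-identityˡ (padʳ (λ j → g (suc j)) q))

sift-padˡ : ∀ {a} (g : Fin a → ℚ) q → sumℚ (λ j → g j ℚ.* δ q (suc j)) ≡ padˡ g q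
sift-padˡ g zero    = sum-zero _ (λ j → *-δ-off (g j) {zero} {suc j} (λ ()))
sift-padˡ g (suc q) = trans (sum-cong (λ j → cong (g j ℚ.*_) (δ-suc q j))) (sift g q)

Δ≡sum-step : ∀ {a} (g : Fin a → ℚ) q → sumℚ (λ j → g j ℚ.* step j q) ≡ Δ g q
Δ≡sum-step g q = begin
  sumℚ (λ j → g j ℚ.* step j q)
    ≡⟨ sum-cong (λ j → ℚP.*-distribˡ-+ (g j) (δ q (inject₁ j)) (ℚ.- δ q (suc j))) ⟩
  sumℚ (λ j → g j ℚ.* δ q (inject₁ j) ℚ.+ g j ℚ.* (ℚ.- δ q (suc j)))
    ≡⟨ sum-cong (λ j → cong (g j ℚ.* δ q (inject₁ j) ℚ.+_) (sym (ℚP.neg-distribʳ-* (g j) (δ q (suc j))))) ⟩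
  sumℚ (λ j → g j ℚ.* δ q (inject₁ j) ℚ.- g j ℚ.* δ q (suc j))
    ≡⟨ sum-- (λ j → g j ℚ.* δ q (inject₁ j)) (λ j → g j ℚ.* δ q (suc j)) ⟩
  sumℚ (λ j → g j ℚ.* δ q (inject₁ j)) ℚ.- sumℚ (λ j → g j ℚ.* δ q (suc j))
    ≡⟨ cong₂ ℚ._-_ (sift-padʳ g q) (sift-padˡ g q) ⟩
  Δ g q ∎
  where open ≡-Reasoning

Zmat : ∀ {a b} → (Fin a → Fin b → ℚ) → Mat ℚ (suc a) (suc b)
Zmat lam p q = sumℚ (λ i → sumℚ (λ j → lam i j ℚ.* U i j p q))

-- Since U_ij = step i ⊗ step j, Zmat λ is the double backward difference of λ.
Zmat≡ΔΔ : ∀ {a b} (lam : Fin a → Fin b → ℚ) p q → Zmat lam p q ≡ Δ (λ i → Δ (lam i) q) p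
Zmat≡ΔΔ lam p q = begin
  sumℚ (λ i → sumℚ (λ j → lam i j ℚ.* U i j p q))
    ≡⟨ sum-cong (λ i → sum-cong (λ j → trans (cong (lam i j ℚ.*_) (U≡step⊗step i j p q))
         (solve 3 (λ l x y → l :* (x :* y) := x :* (l :* y)) refl (lam i j) (step i p) (step j q)))) ⟩
  sumℚ (λ i → sumℚ (λ j → step i p ℚ.* (lam i j ℚ.* step j q)))
    ≡⟨ sum-cong (λ i → trans (sum-scale (step i p) (λ j → lam i j ℚ.* step j q))
         (trans (cong (step i p ℚ.*_) (Δ≡sum-step (lam i) q)) (ℚP.*-comm (step i p) _))) ⟩
  sumℚ (λ i → Δ (lam i) q ℚ.* step i p)
    ≡⟨ Δ≡sum-step (λ i → Δ (lam i) q) p ⟩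
  Δ (λ i → Δ (lam i) q) p ∎
  where open ≡-Reasoning

padʳ-preserves : ∀ {a} (P : ℚ → Set) → P 0ℚ → (g : Fin a → ℚ) → (∀ j → P (g j)) → ∀ q → P (padʳ g q)
padʳ-preserves {zero}  P P0 g Pg zero    = P0
padʳ-preserves {suc a} P P0 g Pg zero    = Pg zero
padʳ-preserves {suc a} P P0 g Pg (suc q) = padʳ-preserves P P0 (λ j → g (suc j)) (λ j → Pg (suc j)) q

padˡ-preserves : ∀ {a} (P : ℚ → Set) → P 0ℚ → (g : Fin a → ℚ) → (∀ j → P (g j)) → ∀ q → P (padˡ g q)
padˡ-preserves P P0 g Pg zero    = P0
padˡ-preserves P P0 g Pg (suc q) = Pg q

InUnit : ℚ → Set
InUnit x = (0ℚ ≤ x) × (x < 1ℚ)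

Within : ℚ → ℚ → Set
Within c x = (ℚ.- c < x) × (x < c)

0<1 : 0ℚ < 1ℚ
0<1 = ℚ.*<* (ℤ.+<+ (ℕ.s≤s ℕ.z≤n))

Within-0 : ∀ {c} → 0ℚ < c → Within c 0ℚ
Within-0 0<c = ℚP.neg-antimono-< 0<c , 0<c

InUnit-diff : ∀ {x y} → InUnit x → InUnit y → Within 1ℚ (x ℚ.- y)
InUnit-diff {x} {y} (0≤x , x<1) (0≤y , y<1) =
  subst (_< x ℚ.- y) (ℚP.+-identityˡ (ℚ.- 1ℚ)) (ℚP.+-mono-≤-< 0≤x (ℚP.neg-antimono-< y<1)) ,
  subst (x ℚ.- y <_) (ℚP.+-identityʳ 1ℚ) (ℚP.+-mono-<-≤ x<1 (ℚP.neg-antimono-≤ 0≤y))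

Within-diff : ∀ {c x y} → Within c x → Within c y → Within (c ℚ.+ c) (x ℚ.- y)
Within-diff {c} {x} {y} (-c<x , x<c) (-c<y , y<c) =
  subst (_< x ℚ.- y) (sym (ℚP.neg-distrib-+ c c)) (ℚP.+-mono-< -c<x (ℚP.neg-antimono-< y<c)) ,
  subst (x ℚ.- y <_) (cong (c ℚ.+_) (neg-involutive c)) (ℚP.+-mono-< x<c (ℚP.neg-antimono-< -c<y))

Δ-InUnit : ∀ {a} (g : Fin a → ℚ) → (∀ j → InUnit (g j)) → ∀ q → Within 1ℚ (Δ g q)
Δ-InUnit g g∈ q = InUnit-diff (padʳ-preserves InUnit 0∈ g g∈ q) (padˡ-preserves InUnit 0∈ g g∈ q)
  where
  0∈ : InUnit 0ℚ
  0∈ = ℚP.≤-refl , 0<1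

Δ-Within : ∀ {a c} → 0ℚ < c → (g : Fin a → ℚ) → (∀ j → Within c (g j)) → ∀ q → Within (c ℚ.+ c) (Δ g q)
Δ-Within {c = c} 0<c g g∈ q =
  Within-diff (padʳ-preserves (Within c) (Within-0 0<c) g g∈ q) (padˡ-preserves (Within c) (Within-0 0<c) g g∈ q)

Zmat-Within : ∀ {a b} (lam : Fin a → Fin b → ℚ) → (∀ i j → InUnit (lam i j)) →
              ∀ p q → Within (1ℚ ℚ.+ 1ℚ) (Zmat lam p q)
Zmat-Within lam lam∈ p q = subst (Within (1ℚ ℚ.+ 1ℚ)) (sym (Zmat≡ΔΔ lam p q))
  (Δ-Within 0<1 (λ i → Δ (lam i) q) (λ i → Δ-InUnit (lam i) (lam∈ i) q) p)

ceiling+2-bounds : ∀ x → (ℕ→ℚ 2 ≤ ι (ceiling x ℤ.+ + 2) ℚ.- x) × (ι (ceiling x ℤ.+ + 2) ℚ.- x < ℕ→ℚ 3)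
ceiling+2-bounds x =
  subst₂ _≤_ (solve 2 (λ x w → (x :- x) :+ w := w) refl x (ℕ→ℚ 2)) (sym shift)
    (ℚP.+-monoˡ-≤ (ℕ→ℚ 2) (ℚP.+-monoˡ-≤ (ℚ.- x) (ceiling-≥ x))) ,
  subst₂ _<_ (sym shift) (solve 2 (λ x o → ((x :+ o) :- x) :+ (o :+ o) := o :+ (o :+ o)) refl x 1ℚ)
    (ℚP.+-monoˡ-< (ℕ→ℚ 2) (ℚP.+-monoˡ-< (ℚ.- x) (ceiling-< x)))
  where
  c : ℤ
  c = ceiling x
  shift : ι (c ℤ.+ + 2) ℚ.- x ≡ (ι c ℚ.- x) ℚ.+ ℕ→ℚ 2
  shift = trans (cong (ℚ._- x) (ι-+ c (+ 2))) (solve 3 (λ a y w → (a :+ w) :- y := (a :- y) :+ w) refl (ι c) x (ℕ→ℚ 2))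

entry-bounds : ∀ {s b z T} → (s ℚ.+ b) ℚ.- T ≡ z → ℕ→ℚ 2 ≤ b → b < ℕ→ℚ 3 → Within (1ℚ ℚ.+ 1ℚ) z →
               (s ≤ T) × (T ≤ s ℚ.+ ℕ→ℚ 5)
entry-bounds {s} {b} {z} {T} eq 2≤b b<3 (-2<z , z<2) =
  subst₂ _≤_ (ℚP.+-identityʳ s) (sym T≡s+b-z)
    (ℚP.+-monoʳ-≤ s (ℚP.<⇒≤ (ℚP.+-mono-≤-< 2≤b (ℚP.neg-antimono-< z<2)))) ,
  subst (_≤ s ℚ.+ ℕ→ℚ 5) (sym T≡s+b-z)
    (ℚP.+-monoʳ-≤ s (ℚP.<⇒≤ (ℚP.+-mono-< b<3 (ℚP.neg-antimono-< -2<z))))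
  where
  T≡s+b-z : T ≡ s ℚ.+ (b ℚ.- z)
  T≡s+b-z = trans (solve 3 (λ s b T → T := s :+ (b :- ((s :+ b) :- T))) refl s b T)
    (cong (λ w → s ℚ.+ (b ℚ.- w)) eq)

σ-mono : ∀ {m n} (S : Fin m → Fin n → Bool) {A A′ : Mat ℚ m n} →
         (∀ i j → A i j ≤ A′ i j) → σℚ S A ≤ σℚ S A′
σ-mono S A≤A′ = sum-mono (λ i → sum-mono (λ j → restrict (S i j) (A≤A′ i j)))
  where
  restrict : ∀ {x y} s → x ≤ y → (if s then x else 0ℚ) ≤ (if s then y else 0ℚ)
  restrict true  x≤y = x≤y
  restrict false _   = ℚP.≤-refl

σ-+const : ∀ {m n} (S : Fin m → Fin n → Bool) (A : Mat ℚ m n) c →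
           σℚ S (λ i j → A i j ℚ.+ c) ≡ σℚ S A ℚ.+ σℚ S (λ _ _ → c)
σ-+const {m} {n} S A c = trans (sum-cong (λ i → trans (sum-cong (λ j → split (S i j))) (sum-+ (σA i) (σc i))))
  (sum-+ (λ i → sumℚ (σA i)) (λ i → sumℚ (σc i)))
  where
  σA σc : Fin m → Fin n → ℚ
  σA i j = if S i j then A i j else 0ℚ
  σc i j = if S i j then c else 0ℚ
  split : ∀ {x} s → (if s then x ℚ.+ c else 0ℚ) ≡ (if s then x else 0ℚ) ℚ.+ (if s then c else 0ℚ)
  split true  = refl
  split false = refl

σ-const : ∀ {m n} (S : Fin m → Fin n → Bool) c → σℚ S (λ _ _ → c) ≡ c ℚ.* ℕ→ℚ (card S)
σ-const {m} {n} S c = begin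
  σℚ S (λ _ _ → c)
    ≡⟨ sum-cong (λ i → trans (sum-cong (λ j → indicator (S i j))) (sum-scale c (χ i))) ⟩
  sumℚ (λ i → c ℚ.* sumℚ (χ i))
    ≡⟨ sum-scale c (λ i → sumℚ (χ i)) ⟩
  c ℚ.* sumℚ (λ i → sumℚ (χ i))
    ≡⟨ cong (c ℚ.*_) (sym (trans (ℕ→ℚ-sum (λ i → sumℕ (λ j → if S i j then 1 else 0)))
                                  (sum-cong (λ i → ℕ→ℚ-sum (λ j → if S i j then 1 else 0))))) ⟩
  c ℚ.* ℕ→ℚ (card S) ∎
  where
  open ≡-Reasoning
  χ : Fin m → Fin n → ℚ
  χ i j = ℕ→ℚ (if S i j then 1 else 0)
  indicator : ∀ s → (if s then c else 0ℚ) ≡ c ℚ.* ℕ→ℚ (if s then 1 else 0)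
  indicator true  = sym (ℚP.*-identityʳ c)
  indicator false = sym (ℚP.*-zeroʳ c)

-- Part (2): t⁻¹ σ_S(D) ≤ σ_S(T D) ≤ t⁻¹ σ_S(D) + 5|S|.  Each entry of T D equals
-- t⁻¹ d + B - Z with B ∈ [2,3) and Z ∈ (-2,2) an entry of a point of Π.
σ-bounds : ∀ {a b} (R : Fin (suc a) → ℕ) (C : Fin (suc b) → ℕ) (t : ℕ) .{{_ : NonZero t}} →
  (D₀ : Mat ℕ (suc a) (suc b)) (T : Mat ℕ (suc a) (suc b) → Mat ℤ (suc a) (suc b)) → IsTScaling t R C D₀ T →
  (S : Fin (suc a) → Fin (suc b) → Bool) (D : Mat ℕ (suc a) (suc b)) → InΣ R C D →
  (σℚ S (scaleInv t D) ≤ σℚ S (λ i j → ℤ→ℚ (T D i j)))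
  × (σℚ S (λ i j → ℤ→ℚ (T D i j)) ≤ σℚ S (scaleInv t D) ℚ.+ ℕ→ℚ (5 * card S))
σ-bounds {a} {b} R C t D₀ T isT S D D∈Σ with isT D D∈Σ
... | lam , lam∈ , Z≡ =
  σ-mono S (λ p q → proj₁ (entry p q)) ,
  subst (σℚ S TD ≤_) σ-shift (σ-mono S (λ p q → proj₂ (entry p q)))
  where
  TD : Mat ℚ (suc a) (suc b)
  TD p q = ℤ→ℚ (T D p q)
  entry : ∀ p q → (scaleInv t D p q ≤ TD p q) × (TD p q ≤ scaleInv t D p q ℚ.+ ℕ→ℚ 5)
  entry p q = entry-bounds (Z≡ p q)
    (proj₁ (ceiling+2-bounds (scaleInv t D₀ p q))) (proj₂ (ceiling+2-bounds (scaleInv t D₀ p q)))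
    (Zmat-Within lam lam∈ p q)
  σ-shift : σℚ S (λ p q → scaleInv t D p q ℚ.+ ℕ→ℚ 5) ≡ σℚ S (scaleInv t D) ℚ.+ ℕ→ℚ (5 * card S)
  σ-shift = trans (σ-+const S (scaleInv t D) (ℕ→ℚ 5))
    (cong (σℚ S (scaleInv t D) ℚ.+_) (trans (σ-const S (ℕ→ℚ 5)) (sym (ℕ→ℚ-* 5 (card S)))))

prefix : {A : Set} → (A → A → A) → ∀ {k} → Fin k → (Fin k → A) → A
prefix _⊕_ zero    h = h zero
prefix _⊕_ (suc i) h = h zero ⊕ prefix _⊕_ i (λ p → h (suc p))

prefix-cong : ∀ {k} (i : Fin k) {h h′ : Fin k → ℚ} → (∀ p → h p ≡ h′ p) →
              prefix ℚ._+_ i h ≡ prefix ℚ._+_ i h′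
prefix-cong zero    h≗h′ = h≗h′ zero
prefix-cong (suc i) h≗h′ = cong₂ ℚ._+_ (h≗h′ zero) (prefix-cong i (λ p → h≗h′ (suc p)))

prefix-- : ∀ {k} (i : Fin k) (h h′ : Fin k → ℚ) →
           prefix ℚ._+_ i (λ p → h p ℚ.- h′ p) ≡ prefix ℚ._+_ i h ℚ.- prefix ℚ._+_ i h′
prefix-- zero    h h′ = refl
prefix-- (suc i) h h′ = trans (cong (h zero ℚ.- h′ zero ℚ.+_) (prefix-- i (λ p → h (suc p)) (λ p → h′ (suc p))))
  (solve 4 (λ a b c d → (a :- b) :+ (c :- d) := (a :+ c) :- (b :+ d)) refl (h zero) (h′ zero) _ _)

prefix-scale : ∀ {k} (i : Fin k) c (h : Fin k → ℚ) → prefix ℚ._+_ i (λ p → c ℚ.* h p) ≡ c ℚ.* prefix ℚ._+_ i h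
prefix-scale zero    c h = refl
prefix-scale (suc i) c h = trans (cong (c ℚ.* h zero ℚ.+_) (prefix-scale i c (λ p → h (suc p))))
  (sym (ℚP.*-distribˡ-+ c (h zero) _))

ℕ→ℚ-prefix : ∀ {k} (i : Fin k) (h : Fin k → ℕ) →
             ℕ→ℚ (prefix ℕ._+_ i h) ≡ prefix ℚ._+_ i (λ p → ℕ→ℚ (h p))
ℕ→ℚ-prefix zero    h = refl
ℕ→ℚ-prefix (suc i) h =
  trans (ℕ→ℚ-+ (h zero) _) (cong (ℕ→ℚ (h zero) ℚ.+_) (ℕ→ℚ-prefix i (λ p → h (suc p))))

delay : ∀ {k} → ℚ → (Fin (suc k) → ℚ) → Fin (suc k) → ℚ
delay c h zero    = c
delay c h (suc p) = h (inject₁ p)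

prefix-telescope : ∀ {k} (i : Fin (suc k)) c (h : Fin (suc k) → ℚ) →
                   prefix ℚ._+_ i (λ p → h p ℚ.- delay c h p) ≡ h i ℚ.- c
prefix-telescope zero    c h = refl
prefix-telescope {suc k} (suc i) c h = begin
  (h zero ℚ.- c) ℚ.+ prefix ℚ._+_ i (λ p → h (suc p) ℚ.- delay c h (suc p))
    ≡⟨ cong ((h zero ℚ.- c) ℚ.+_) (prefix-cong i (λ p → cong (λ x → h (suc p) ℚ.- x) (delay-suc p))) ⟩
  (h zero ℚ.- c) ℚ.+ prefix ℚ._+_ i (λ p → h (suc p) ℚ.- delay (h zero) (λ p → h (suc p)) p)
    ≡⟨ cong ((h zero ℚ.- c) ℚ.+_) (prefix-telescope i (h zero) (λ p → h (suc p))) ⟩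
  (h zero ℚ.- c) ℚ.+ (h (suc i) ℚ.- h zero)
    ≡⟨ solve 3 (λ x y z → (x :- z) :+ (y :- x) := y :- z) refl (h zero) (h (suc i)) c ⟩
  h (suc i) ℚ.- c ∎
  where
  open ≡-Reasoning
  delay-suc : ∀ p → delay c h (suc p) ≡ delay (h zero) (λ p → h (suc p)) p
  delay-suc zero    = refl
  delay-suc (suc p) = refl

padʳ-inject₁ : ∀ {a} (g : Fin a → ℚ) j → padʳ g (inject₁ j) ≡ g j
padʳ-inject₁ {suc a} g zero    = refl
padʳ-inject₁ {suc a} g (suc j) = padʳ-inject₁ (λ j → g (suc j)) j

prefix-Δ : ∀ {a} (g : Fin a → ℚ) i → prefix ℚ._+_ (inject₁ i) (Δ g) ≡ g i
prefix-Δ g i = begin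
  prefix ℚ._+_ (inject₁ i) (Δ g)
    ≡⟨ prefix-cong (inject₁ i) (λ p → cong (λ x → padʳ g p ℚ.- x) (padˡ≡delay p)) ⟩
  prefix ℚ._+_ (inject₁ i) (λ p → padʳ g p ℚ.- delay 0ℚ (padʳ g) p)
    ≡⟨ prefix-telescope (inject₁ i) 0ℚ (padʳ g) ⟩
  padʳ g (inject₁ i) ℚ.- 0ℚ
    ≡⟨ trans (ℚP.+-identityʳ _) (padʳ-inject₁ g i) ⟩
  g i ∎
  where
  open ≡-Reasoning
  padˡ≡delay : ∀ p → padˡ g p ≡ delay 0ℚ (padʳ g) p
  padˡ≡delay zero    = refl
  padˡ≡delay (suc p) = sym (padʳ-inject₁ g p)

blockSum : {A : Set} → (A → A → A) → ∀ {a b} → Mat A (suc a) (suc b) → Fin a → Fin b → A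
blockSum _⊕_ M i j = prefix _⊕_ (inject₁ j) (λ q → prefix _⊕_ (inject₁ i) (λ p → M p q))

blockSum-cong : ∀ {a b} {M M′ : Mat ℚ (suc a) (suc b)} → (∀ p q → M p q ≡ M′ p q) →
                ∀ i j → blockSum ℚ._+_ M i j ≡ blockSum ℚ._+_ M′ i j
blockSum-cong M≈M′ i j = prefix-cong (inject₁ j) (λ q → prefix-cong (inject₁ i) (λ p → M≈M′ p q))

blockSum-Zmat : ∀ {a b} (lam : Fin a → Fin b → ℚ) i j → blockSum ℚ._+_ (Zmat lam) i j ≡ lam i j
blockSum-Zmat lam i j = trans
  (prefix-cong (inject₁ j) (λ q → trans (prefix-cong (inject₁ i) (λ p → Zmat≡ΔΔ lam p q))
                                        (prefix-Δ (λ i → Δ (lam i) q) i)))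
  (prefix-Δ (lam i) j)

blockSum-- : ∀ {a b} (M M′ : Mat ℚ (suc a) (suc b)) i j →
             blockSum ℚ._+_ (λ p q → M p q ℚ.- M′ p q) i j ≡ blockSum ℚ._+_ M i j ℚ.- blockSum ℚ._+_ M′ i j
blockSum-- M M′ i j = trans
  (prefix-cong (inject₁ j) (λ q → prefix-- (inject₁ i) (λ p → M p q) (λ p → M′ p q)))
  (prefix-- (inject₁ j) (λ q → prefix ℚ._+_ (inject₁ i) (λ p → M p q))
                        (λ q → prefix ℚ._+_ (inject₁ i) (λ p → M′ p q)))

blockSum-scale : ∀ {a b} c (M : Mat ℚ (suc a) (suc b)) i j →
                 blockSum ℚ._+_ (λ p q → c ℚ.* M p q) i j ≡ c ℚ.* blockSum ℚ._+_ M i j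
blockSum-scale c M i j = trans
  (prefix-cong (inject₁ j) (λ q → prefix-scale (inject₁ i) c (λ p → M p q)))
  (prefix-scale (inject₁ j) c (λ q → prefix ℚ._+_ (inject₁ i) (λ p → M p q)))

ℕ→ℚ-blockSum : ∀ {a b} (D : Mat ℕ (suc a) (suc b)) i j →
               ℕ→ℚ (blockSum ℕ._+_ D i j) ≡ blockSum ℚ._+_ (λ p q → ℕ→ℚ (D p q)) i j
ℕ→ℚ-blockSum D i j = trans
  (ℕ→ℚ-prefix (inject₁ j) (λ q → prefix ℕ._+_ (inject₁ i) (λ p → D p q)))
  (prefix-cong (inject₁ j) (λ q → ℕ→ℚ-prefix (inject₁ i) (λ p → D p q)))

blockSum-scaleInv : ∀ {a b} t′ (D : Mat ℕ (suc a) (suc b)) i j →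
  ℕ→ℚ (suc t′) ℚ.* blockSum ℚ._+_ (scaleInv (suc t′) D) i j ≡ ℕ→ℚ (blockSum ℕ._+_ D i j)
blockSum-scaleInv t′ D i j = trans (sym (blockSum-scale (ℕ→ℚ (suc t′)) (scaleInv (suc t′) D) i j))
  (trans (blockSum-cong (λ p q → ℕ→ℚ-*-/ t′ (D p q)) i j) (sym (ℕ→ℚ-blockSum D i j)))

quotient-gap : ∀ t x y .{{_ : NonZero t}} → x ℕ.% t ≡ y ℕ.% t → x ℕ./ t ℕ.< y ℕ./ t → x ℕ.+ t ℕ.≤ y
quotient-gap t x y x%t≡y%t x/t<y/t = subst₂ ℕ._≤_ eq (sym (m≡m%n+[m/n]*n y t))
  (ℕP.+-monoʳ-≤ (y ℕ.% t) (ℕP.*-monoˡ-≤ t x/t<y/t))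
  where
  r q : ℕ
  r = x ℕ.% t
  q = x ℕ./ t
  eq : y ℕ.% t ℕ.+ suc q * t ≡ x ℕ.+ t
  eq = begin
    y ℕ.% t ℕ.+ (t ℕ.+ q * t)   ≡⟨ cong (λ z → z ℕ.+ (t ℕ.+ q * t)) (sym x%t≡y%t) ⟩
    r ℕ.+ (t ℕ.+ q * t)         ≡⟨ cong (r ℕ.+_) (ℕP.+-comm t (q * t)) ⟩
    r ℕ.+ (q * t ℕ.+ t)         ≡⟨ sym (ℕP.+-assoc r (q * t) t) ⟩
    r ℕ.+ q * t ℕ.+ t           ≡⟨ cong (ℕ._+ t) (sym (m≡m%n+[m/n]*n x t)) ⟩
    x ℕ.+ t                     ∎
    where open ≡-Reasoning

mod-unique : ∀ t x y .{{_ : NonZero t}} → x ℕ.% t ≡ y ℕ.% t → x ℕ.< y ℕ.+ t → y ℕ.< x ℕ.+ t → x ≡ y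
mod-unique t x y x%t≡y%t x<y+t y<x+t with ℕP.<-cmp (x ℕ./ t) (y ℕ./ t)
... | tri< x/t<y/t _ _ = ⊥-elim (ℕP.<⇒≱ y<x+t (quotient-gap t x y x%t≡y%t x/t<y/t))
... | tri> _ _ y/t<x/t = ⊥-elim (ℕP.<⇒≱ x<y+t (quotient-gap t y x (sym x%t≡y%t) y/t<x/t))
... | tri≈ _ x/t≡y/t _ = trans (m≡m%n+[m/n]*n x t)
  (trans (cong₂ (λ r d → r ℕ.+ d * t) x%t≡y%t x/t≡y/t) (sym (m≡m%n+[m/n]*n y t)))

diff<⇒< : ∀ m n t → ℕ→ℚ m ℚ.- ℕ→ℚ n < ℕ→ℚ t → m ℕ.< n ℕ.+ t
diff<⇒< m n t m-n<t = ℕ→ℚ-cancel-< (subst₂ _<_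
  (solve 2 (λ m n → (m :- n) :+ n := m) refl (ℕ→ℚ m) (ℕ→ℚ n))
  (trans (ℚP.+-comm (ℕ→ℚ t) (ℕ→ℚ n)) (sym (ℕ→ℚ-+ n t)))
  (ℚP.+-monoˡ-< (ℕ→ℚ n) m-n<t))

scaled-diff-close : ∀ t′ m n x → ℕ→ℚ (suc t′) ℚ.* x ≡ ℕ→ℚ m ℚ.- ℕ→ℚ n → Within 1ℚ x →
                    (m ℕ.< n ℕ.+ suc t′) × (n ℕ.< m ℕ.+ suc t′)
scaled-diff-close t′ m n x tx≡m-n (-1<x , x<1) =
  diff<⇒< m n (suc t′) (subst₂ _<_ tx≡m-n (ℚP.*-identityʳ τ) (ℚP.*-monoʳ-<-pos τ x<1)) ,
  diff<⇒< n m (suc t′) (subst₂ _<_ n-m (neg-involutive τ) (ℚP.neg-antimono-< τ·-1<τx))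
  where
  τ : ℚ
  τ = ℕ→ℚ (suc t′)
  instance
    τ-positive : ℚ.Positive τ
    τ-positive = ℕ→ℚ-suc-positive t′
  τ·-1<τx : ℚ.- τ < ℕ→ℚ m ℚ.- ℕ→ℚ n
  τ·-1<τx = subst₂ _<_ (trans (sym (ℚP.neg-distribʳ-* τ 1ℚ)) (cong ℚ.-_ (ℚP.*-identityʳ τ))) tx≡m-n
    (ℚP.*-monoʳ-<-pos τ -1<x)
  n-m : ℚ.- (ℕ→ℚ m ℚ.- ℕ→ℚ n) ≡ ℕ→ℚ n ℚ.- ℕ→ℚ m
  n-m = solve 2 (λ m n → :- (m :- n) := n :- m) refl (ℕ→ℚ m) (ℕ→ℚ n)

scaled-zero : ∀ t′ x → ℕ→ℚ (suc t′) ℚ.* x ≡ 0ℚ → x ≡ 0ℚ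
scaled-zero t′ x tx≡0 = ℚP.≤-antisym
  (ℚP.*-cancelˡ-≤-pos τ (ℚP.≤-reflexive (trans tx≡0 (sym (ℚP.*-zeroʳ τ)))))
  (ℚP.*-cancelˡ-≤-pos τ (ℚP.≤-reflexive (trans (ℚP.*-zeroʳ τ) (sym tx≡0))))
  where
  τ : ℚ
  τ = ℕ→ℚ (suc t′)
  instance
    τ-positive : ℚ.Positive τ
    τ-positive = ℕ→ℚ-suc-positive t′

-- Writing t⁻¹D + B - T D = Σ λ_ij U_ij, the block sums give t(λ - λ′) = N - N′ for the
-- integer block sums N, N′ of D, D′; as |λ - λ′| < 1 this forces N = N′, then λ = λ′, D = D′.
fibre-determined-by-residues : ∀ {a b} t′ (R : Fin (suc a) → ℕ) (C : Fin (suc b) → ℕ)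
  (D₀ : Mat ℕ (suc a) (suc b)) (T : Mat ℕ (suc a) (suc b) → Mat ℤ (suc a) (suc b)) →
  IsTScaling (suc t′) R C D₀ T → ∀ {D D′} → InΣ R C D → InΣ R C D′ → T D ≈M T D′ →
  (∀ i j → blockSum ℕ._+_ D i j ℕ.% suc t′ ≡ blockSum ℕ._+_ D′ i j ℕ.% suc t′) → D ≈M D′
fibre-determined-by-residues {a} {b} t′ R C D₀ T isT {D} {D′} D∈Σ D′∈Σ TD≈TD′ residues≡
  with isT D D∈Σ | isT D′ D′∈Σ
... | lam , lam∈ , Z≡ | lam′ , lam′∈ , Z′≡ = D≈D′
  where
  τ : ℚ
  τ = ℕ→ℚ (suc t′)
  s s′ : Mat ℚ (suc a) (suc b)
  s = scaleInv (suc t′) D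
  s′ = scaleInv (suc t′) D′
  N N′ : Fin a → Fin b → ℕ
  N = blockSum ℕ._+_ D
  N′ = blockSum ℕ._+_ D′

  -- B and the common value of T cancel.
  Z-diff : ∀ p q → Zmat lam p q ℚ.- Zmat lam′ p q ≡ s p q ℚ.- s′ p q
  Z-diff p q = begin
    Zmat lam p q ℚ.- Zmat lam′ p q
      ≡⟨ cong₂ ℚ._-_ (sym (Z≡ p q)) (sym (Z′≡ p q)) ⟩
    ((s p q ℚ.+ B) ℚ.- ι (T D p q)) ℚ.- ((s′ p q ℚ.+ B) ℚ.- ι (T D′ p q))
      ≡⟨ cong (λ y → ((s p q ℚ.+ B) ℚ.- ι (T D p q)) ℚ.- ((s′ p q ℚ.+ B) ℚ.- ι y))
              (sym (TD≈TD′ p q)) ⟩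
    ((s p q ℚ.+ B) ℚ.- ι (T D p q)) ℚ.- ((s′ p q ℚ.+ B) ℚ.- ι (T D p q))
      ≡⟨ solve 4 (λ x x′ B y → ((x :+ B) :- y) :- ((x′ :+ B) :- y) := x :- x′) refl
              (s p q) (s′ p q) B (ι (T D p q)) ⟩
    s p q ℚ.- s′ p q ∎
    where
    open ≡-Reasoning
    B : ℚ
    B = Bmat (suc t′) D₀ p q

  coordinate-diff : ∀ i j → τ ℚ.* (lam i j ℚ.- lam′ i j) ≡ ℕ→ℚ (N i j) ℚ.- ℕ→ℚ (N′ i j)
  coordinate-diff i j = begin
    τ ℚ.* (lam i j ℚ.- lam′ i j)
      ≡⟨ cong (τ ℚ.*_) (cong₂ ℚ._-_ (sym (blockSum-Zmat lam i j)) (sym (blockSum-Zmat lam′ i j))) ⟩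
    τ ℚ.* (blockSum ℚ._+_ (Zmat lam) i j ℚ.- blockSum ℚ._+_ (Zmat lam′) i j)
      ≡⟨ cong (τ ℚ.*_) (sym (blockSum-- (Zmat lam) (Zmat lam′) i j)) ⟩
    τ ℚ.* blockSum ℚ._+_ (λ p q → Zmat lam p q ℚ.- Zmat lam′ p q) i j
      ≡⟨ cong (τ ℚ.*_) (trans (blockSum-cong Z-diff i j) (blockSum-- s s′ i j)) ⟩
    τ ℚ.* (blockSum ℚ._+_ s i j ℚ.- blockSum ℚ._+_ s′ i j)
      ≡⟨ ℚP.*-distribˡ-+ τ (blockSum ℚ._+_ s i j) (ℚ.- blockSum ℚ._+_ s′ i j) ⟩
    τ ℚ.* blockSum ℚ._+_ s i j ℚ.+ τ ℚ.* (ℚ.- blockSum ℚ._+_ s′ i j)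
      ≡⟨ cong (τ ℚ.* blockSum ℚ._+_ s i j ℚ.+_) (sym (ℚP.neg-distribʳ-* τ (blockSum ℚ._+_ s′ i j))) ⟩
    τ ℚ.* blockSum ℚ._+_ s i j ℚ.- τ ℚ.* blockSum ℚ._+_ s′ i j
      ≡⟨ cong₂ ℚ._-_ (blockSum-scaleInv t′ D i j) (blockSum-scaleInv t′ D′ i j) ⟩
    ℕ→ℚ (N i j) ℚ.- ℕ→ℚ (N′ i j) ∎
    where open ≡-Reasoning

  N≡N′ : ∀ i j → N i j ≡ N′ i j
  N≡N′ i j = mod-unique (suc t′) (N i j) (N′ i j) (residues≡ i j)
    (proj₁ close) (proj₂ close)
    where
    close : (N i j ℕ.< N′ i j ℕ.+ suc t′) × (N′ i j ℕ.< N i j ℕ.+ suc t′)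
    close = scaled-diff-close t′ (N i j) (N′ i j) (lam i j ℚ.- lam′ i j) (coordinate-diff i j)
      (InUnit-diff (lam∈ i j) (lam′∈ i j))

  lam≡lam′ : ∀ i j → lam i j ≡ lam′ i j
  lam≡lam′ i j = x-y≡0⇒x≡y (lam i j) (lam′ i j) (scaled-zero t′ (lam i j ℚ.- lam′ i j)
    (trans (coordinate-diff i j) (x≡y⇒x-y≡0 (cong ℕ→ℚ (N≡N′ i j)))))

  D≈D′ : D ≈M D′
  D≈D′ p q = ℕ→ℚ-injective (begin
    ℕ→ℚ (D p q)          ≡⟨ sym (ℕ→ℚ-*-/ t′ (D p q)) ⟩
    τ ℚ.* s p q          ≡⟨ cong (τ ℚ.*_) (x-y≡0⇒x≡y (s p q) (s′ p q) s-s′≡0) ⟩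
    τ ℚ.* s′ p q         ≡⟨ ℕ→ℚ-*-/ t′ (D′ p q) ⟩
    ℕ→ℚ (D′ p q)         ∎)
    where
    open ≡-Reasoning
    s-s′≡0 : s p q ℚ.- s′ p q ≡ 0ℚ
    s-s′≡0 = trans (sym (Z-diff p q))
      (x≡y⇒x-y≡0 (sum-cong (λ i → sum-cong (λ j → cong (ℚ._* U i j p q) (lam≡lam′ i j)))))

AllPairs-lookup : ∀ {A : Set} {R : A → A → Set} {xs : List A} → AllPairs R xs → ∀ {i j} → i ≢ j →
                  R (lookup xs i) (lookup xs j) ⊎ R (lookup xs j) (lookup xs i)
AllPairs-lookup (_ ∷ _)   {zero}  {zero}  i≢j = ⊥-elim (i≢j refl)
AllPairs-lookup (px ∷ _)  {zero}  {suc j} _   = inj₁ (All.lookup px (∈-lookup j))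
AllPairs-lookup (px ∷ _)  {suc i} {zero}  _   = inj₂ (All.lookup px (∈-lookup i))
AllPairs-lookup (_ ∷ pxs) {suc i} {suc j} i≢j = AllPairs-lookup pxs (λ i≡j → i≢j (cong suc i≡j))

distinct-list-bound : ∀ {A : Set} {_≈_ : A → A → Set} {P : A → Set} {N} (f : A → Fin N) →
  (∀ {x y} → x ≈ y → y ≈ x) → (∀ {x y} → P x → P y → f x ≡ f y → x ≈ y) →
  ∀ {xs} → AllPairs (λ x y → ¬ x ≈ y) xs → All P xs → length xs ℕ.≤ N
distinct-list-bound {A} {_≈_} {P} f ≈-sym f-inj {xs} distinct all-P = FinP.injective⇒≤ f∘lookup-injective
  where
  P-at : ∀ i → P (lookup xs i)
  P-at i = All.lookup all-P (∈-lookup i)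
  f∘lookup-injective : ∀ {i j} → f (lookup xs i) ≡ f (lookup xs j) → i ≡ j
  f∘lookup-injective {i} {j} fi≡fj with i Fin.≟ j
  ... | yes i≡j = i≡j
  ... | no i≢j with AllPairs-lookup distinct i≢j
  ...   | inj₁ xi≉xj = ⊥-elim (xi≉xj (f-inj (P-at i) (P-at j) fi≡fj))
  ...   | inj₂ xj≉xi = ⊥-elim (xj≉xi (≈-sym (f-inj (P-at i) (P-at j) fi≡fj)))

encodeMat : ∀ {a b t} → (Fin a → Fin b → Fin t) → Fin ((t ^ b) ^ a)
encodeMat k = Fin.funToFin (λ i → Fin.funToFin (k i))

funToFin-injective : ∀ {m n} (f g : Fin m → Fin n) → Fin.funToFin f ≡ Fin.funToFin g → ∀ i → f i ≡ g i
funToFin-injective f g e i =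
  trans (sym (FinP.finToFun-funToFin f i)) (trans (cong (λ x → Fin.finToFun x i) e) (FinP.finToFun-funToFin g i))

encodeMat-injective : ∀ {a b t} (k k′ : Fin a → Fin b → Fin t) →
                      encodeMat k ≡ encodeMat k′ → ∀ i j → k i j ≡ k′ i j
encodeMat-injective k k′ e i j = funToFin-injective (k i) (k′ i) rows≡ j
  where
  rows≡ : Fin.funToFin (k i) ≡ Fin.funToFin (k′ i)
  rows≡ = funToFin-injective (λ i → Fin.funToFin (k i)) (λ i → Fin.funToFin (k′ i)) e i

-- Part (1): a fibre of T has at most t^{ab} elements, since D ↦ (block sums of D mod t)
-- is injective on it and takes at most t^{ab} values.
fibre-bound : ∀ {a b} t′ (R : Fin (suc a) → ℕ) (C : Fin (suc b) → ℕ) (D₀ : Mat ℕ (suc a) (suc b))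
  (T : Mat ℕ (suc a) (suc b) → Mat ℤ (suc a) (suc b)) → IsTScaling (suc t′) R C D₀ T →
  (Y : Mat ℕ (suc a) (suc b)) (Ds : List (Mat ℕ (suc a) (suc b))) →
  AllPairs (λ D D′ → ¬ (D ≈M D′)) Ds → All (λ D → InΣ R C D × (T D ≈M (λ i j → + Y i j))) Ds →
  length Ds ℕ.≤ suc t′ ^ (a * b)
fibre-bound {a} {b} t′ R C D₀ T isT Y Ds distinct in-fibre =
  subst (length Ds ℕ.≤_) (trans (ℕP.^-*-assoc (suc t′) b a) (cong (suc t′ ^_) (ℕP.*-comm b a)))
    (distinct-list-bound fingerprint (λ D≈D′ i j → sym (D≈D′ i j)) fingerprint-injective distinct in-fibre)
  where
  N : Mat ℕ (suc a) (suc b) → Fin a → Fin b → ℕ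
  N = blockSum ℕ._+_
  residues : Mat ℕ (suc a) (suc b) → Fin a → Fin b → Fin (suc t′)
  residues D i j = Fin.fromℕ< (m%n<n (N D i j) (suc t′))
  fingerprint : Mat ℕ (suc a) (suc b) → Fin ((suc t′ ^ b) ^ a)
  fingerprint D = encodeMat (residues D)
  InFibre : Mat ℕ (suc a) (suc b) → Set
  InFibre D = InΣ R C D × (T D ≈M (λ i j → + Y i j))
  fingerprint-injective : ∀ {D D′} → InFibre D → InFibre D′ → fingerprint D ≡ fingerprint D′ → D ≈M D′
  fingerprint-injective {D} {D′} (D∈Σ , TD≈Y) (D′∈Σ , TD′≈Y) e =
    fibre-determined-by-residues t′ R C D₀ T isT D∈Σ D′∈Σ
      (λ i j → trans (TD≈Y i j) (sym (TD′≈Y i j))) residues≡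
    where
    residues≡ : ∀ i j → N D i j ℕ.% suc t′ ≡ N D′ i j ℕ.% suc t′
    residues≡ i j = begin
      N D i j ℕ.% suc t′          ≡⟨ sym (FinP.toℕ-fromℕ< (m%n<n (N D i j) (suc t′))) ⟩
      Fin.toℕ (residues D i j)    ≡⟨ cong Fin.toℕ (encodeMat-injective (residues D) (residues D′) e i j) ⟩
      Fin.toℕ (residues D′ i j)   ≡⟨ FinP.toℕ-fromℕ< (m%n<n (N D′ i j) (suc t′)) ⟩
      N D′ i j ℕ.% suc t′         ∎
      where open ≡-Reasoning

lemma4p3 : (a b : ℕ) (R : Fin (suc a) → ℕ) (C : Fin (suc b) → ℕ) →
    (∀ i → 0 ℕ.< R i) → (∀ j → 0 ℕ.< C j) → sumℕ R ≡ sumℕ C →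
    (t : ℕ) .{{_ : NonZero t}} →
    (D₀ : Mat ℕ (suc a) (suc b)) → InΣ R C D₀ →
    (T : Mat ℕ (suc a) (suc b) → Mat ℤ (suc a) (suc b)) → IsTScaling t R C D₀ T →
    ((Y : Mat ℕ (suc a) (suc b)) → InΣ' (D₁ t D₀) Y →
       (Ds : List (Mat ℕ (suc a) (suc b))) →
       AllPairs (λ D D' → ¬ (D ≈M D')) Ds →
       All (λ D → InΣ R C D × (T D ≈M (λ i j → + Y i j))) Ds →
       length Ds ℕ.≤ t ^ (a * b))
    ×
    ((S : Fin (suc a) → Fin (suc b) → Bool) (D : Mat ℕ (suc a) (suc b)) → InΣ R C D →
       (σℚ S (scaleInv t D) ≤ σℚ S (λ i j → ℤ→ℚ (T D i j)))
       × (σℚ S (λ i j → ℤ→ℚ (T D i j)) ≤ σℚ S (scaleInv t D) ℚ.+ ℕ→ℚ (5 * card S)))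
lemma4p3 a b R C _ _ _ (suc t′) D₀ _ T isT =
  (λ Y _ → fibre-bound t′ R C D₀ T isT Y) ,
  σ-bounds R C (suc t′) D₀ T isT
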